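{- Let $G$ be a finite simple connected graph with $m$ edges and let $k \geq 2$ be an integer. Then $$\chi_{dd}(P_{k+1}) \leq \chi_{dd}(S_k(G)) \leq (m-1)\chi_{dd}(P_k) + \chi_{dd}(P_{k+1}).$$
   Context: All graphs are finite, simple, undirected and connected. For a vertex $v$, $N[v]$ denotes its closed neighborhood. A proper coloring of $G$ partitions $V(G)$ into independent sets $V_1,\dots,V_k$ (color classes). A vertex $u$ dominates a color class $V_i$ if $V_i \subseteq N[u]$ (so $u$ dominates its own class only when that class is $\{u\}$). A domination coloring of $G$ is a proper vertex coloring such that every vertex of $G$ dominates at least one color class, and every color class is dominated by at least one vertex. The domination chromatic number $\chi_{dd}(G)$ is the minimum number of color classes in a domination coloring of $G$. $P_n$ denotes the path on $n$ vertices. For a positive integer $k$, the $k$-subdivision $S_k(G)$ is the graph obtained from $G$ by replacing each edge $uv$ with a path of length $k$ (i.e., with $k-1$ new internal vertices) between $u$ and $v$, the new internal vertices being distinct for distinct edges. -}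

module Defs where

open import Data.Nat using (ℕ; zero; suc; _+_; _*_; _∸_; _≤_)
open import Data.Fin using (Fin; zero; suc; inject₁; _↑ˡ_; _↑ʳ_; combine)
open import Data.List using (List; []; _∷_; _++_; [_]; map; concatMap; length; lookup; allFin)
open import Data.List.Relation.Unary.All using (All)
open import Data.List.Relation.Unary.AllPairs using (AllPairs)
open import Data.List.Membership.Propositional using (_∈_)
open import Data.Product using (_×_; _,_; proj₁; proj₂; ∃; ∃-syntax)
open import Data.Sum using (_⊎_)
open import Relation.Nullary using (¬_)
open import Relation.Binary.PropositionalEquality using (_≡_; _≢_)
open import Relation.Binary.Construct.Closure.ReflexiveTransitive using (Star)

-- A (multi)graph given by a vertex count and a list of edges (u , v);
-- each list entry is one (undirected) edge.
record Graph : Set where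
  constructor mkGraph
  field
    V : ℕ
    E : List (Fin V × Fin V)
open Graph public

numEdges : Graph → ℕ
numEdges G = length (E G)

Adj : (G : Graph) → Fin (V G) → Fin (V G) → Set
Adj G u v = ((u , v) ∈ E G) ⊎ ((v , u) ∈ E G)

SameEdge : {n : ℕ} → (Fin n × Fin n) → (Fin n × Fin n) → Set
SameEdge (a , b) (c , d) = ((a ≡ c) × (b ≡ d)) ⊎ ((a ≡ d) × (b ≡ c))

Simple : Graph → Set
Simple G = All (λ e → proj₁ e ≢ proj₂ e) (E G)
         × AllPairs (λ e f → ¬ SameEdge e f) (E G)

Connected : Graph → Set
Connected G = ∀ u v → Star (Adj G) u v

pathGraph : ℕ → Graph
pathGraph zero    = mkGraph zero []
pathGraph (suc n) = mkGraph (suc n) (map (λ i → inject₁ i , suc i) (allFin n))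

consecPairs : {A : Set} → List A → List (A × A)
consecPairs []            = []
consecPairs (x ∷ [])      = []
consecPairs (x ∷ y ∷ xs)  = (x , y) ∷ consecPairs (y ∷ xs)

-- k-subdivision S_k(G): edge number j, (u , v), is replaced by the path
-- u, w(j,0), …, w(j,k-2), v  (k-1 new internal vertices per edge).
-- Vertices: original vertices first, then internal vertices combine j t.
subdivision : ℕ → Graph → Graph
subdivision k G =
  mkGraph (V G + numEdges G * (k ∸ 1)) (concatMap chain (allFin (numEdges G)))
  where
    orig : Fin (V G) → Fin (V G + numEdges G * (k ∸ 1))
    orig u = u ↑ˡ (numEdges G * (k ∸ 1))
    inner : Fin (numEdges G) → Fin (k ∸ 1) → Fin (V G + numEdges G * (k ∸ 1))
    inner j t = V G ↑ʳ combine j t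
    chain : Fin (numEdges G) → List (Fin (V G + numEdges G * (k ∸ 1)) × Fin (V G + numEdges G * (k ∸ 1)))
    chain j = consecPairs (orig (proj₁ (lookup (E G) j))
                 ∷ (map (inner j) (allFin (k ∸ 1)) ++ [ orig (proj₂ (lookup (E G) j)) ]))

Dominates : (G : Graph) {t : ℕ} → (Fin (V G) → Fin t) → Fin (V G) → Fin t → Set
Dominates G c u i = ∀ v → c v ≡ i → (v ≡ u) ⊎ Adj G u v

IsDomColoring : (G : Graph) (t : ℕ) → (Fin (V G) → Fin t) → Set
IsDomColoring G t c =
    (∀ u v → Adj G u v → c u ≢ c v)
  × (∀ i → ∃[ v ] c v ≡ i)
  × (∀ u → ∃[ i ] Dominates G c u i)
  × (∀ i → ∃[ u ] Dominates G c u i)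

HasDomColoring : Graph → ℕ → Set
HasDomColoring G t = ∃[ c ] IsDomColoring G t c

IsChiDD : Graph → ℕ → Set
IsChiDD G t = HasDomColoring G t × (∀ s → HasDomColoring G s → t ≤ s)

-- Lower bound: the chain replacing an edge e of G is an induced P_{k+1} in S_k(G), and since
-- G is simple no vertex off the chain is adjacent to both of its ends.  Restricting a
-- domination colouring of S_k(G) to the chain therefore keeps every class dominated, and
-- every inner vertex still dominates a class; an end that no longer does is given a fresh
-- colour of its own.  Upper bound: a spanning tree grown from an edge e₀ sends every vertex
-- to an incident edge, injectively except at the two ends of e₀.  This cuts S_k(G) into the
-- chain of e₀, a P_{k+1}, and for every other edge its k−1 inner vertices plus at most one
-- end, a P_k or P_{k−1}.  Colouring the pieces from disjoint palettes with χ_dd(P_{k+1}) and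
-- χ_dd(P_k) ≥ χ_dd(P_{k−1}) colours gives a domination colouring of S_k(G).

module Submission where

open import Defs
open import Data.Empty using (⊥-elim; ⊥)
open import Data.Fin using (Fin; zero; suc; punchOut; inject₁; fromℕ; _↑ˡ_; _↑ʳ_; combine; splitAt; remQuot)
open import Data.Fin.Properties using (any?; all?; ¬∀⟶∃¬; punchOut-injective; inject₁-injective; fromℕ≢inject₁; suc-injective; ↑ˡ-injective; ↑ʳ-injective; splitAt-↑ˡ; splitAt-↑ʳ; combine-injective; 0≢1+n; remQuot-combine; combine-remQuot; splitAt⁻¹-↑ˡ; splitAt⁻¹-↑ʳ) renaming (_≟_ to _≟ᶠ_)
open import Data.Fin.Relation.Unary.Top using (view; ‵fromℕ; ‵inj₁)
open import Data.List using (List; _∷_; lookup; map; allFin; []; _++_; [_]; tabulate; length)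
import Data.List.Membership.DecPropositional as DecMembership
open import Data.List.Membership.Propositional using (_∈_)
open import Data.List.Membership.Propositional.Properties using (∈-lookup; ∈-map⁻; ∈-map⁺; ∈-allFin; ∈-concatMap⁻; ∈-concatMap⁺; ∈-tabulate⁻; ∈-tabulate⁺)
open import Data.List.Properties using (map-tabulate)
open import Data.List.Relation.Unary.All as All using (All; []; _∷_)
open import Data.List.Relation.Unary.AllPairs using (AllPairs; _∷_)
open import Data.List.Relation.Unary.Any as Any using (index; satisfied)
open import Data.List.Relation.Unary.Any.Properties using (lookup-index)
open import Data.Maybe using (Maybe; just; nothing)
open import Data.Maybe.Properties using (just-injective)
open import Data.Nat using (ℕ; zero; suc; _≤_; _+_; _*_; _∸_; z≤n; s≤s)
open import Data.Nat.Properties using (≤-refl; m≤n⇒m≤1+n; ≤-trans; +-comm)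
open import Data.Product using (_×_; _,_; proj₁; proj₂; ∃-syntax; Σ; uncurry)
open import Data.Product.Properties using (≡-dec)
open import Data.Sum as Sum using (_⊎_; inj₁; inj₂)
open import Data.Unit using (tt)
open import Function using (_∘_; case_of_)
open import Relation.Binary.Construct.Closure.ReflexiveTransitive using (Star; ε; _◅_)
open import Relation.Binary.PropositionalEquality using (_≡_; _≢_; refl; sym; cong; trans; subst; module ≡-Reasoning)
open import Relation.Nullary using (Dec; yes; no; ¬_)
open import Relation.Nullary.Decidable using (_⊎-dec_)
open import Relation.Unary using (Pred; U; _⊆_; _∪_)

allPairs-lookup : ∀ {A : Set} {R : A → A → Set} {xs : List A} → AllPairs R xs →
  ∀ i j → i ≢ j → R (lookup xs i) (lookup xs j) ⊎ R (lookup xs j) (lookup xs i)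
allPairs-lookup (_ ∷ _)  zero    zero    i≢j = ⊥-elim (i≢j refl)
allPairs-lookup (r ∷ _)  zero    (suc j) _   = inj₁ (All.lookup r (∈-lookup j))
allPairs-lookup (r ∷ _)  (suc i) zero    _   = inj₂ (All.lookup r (∈-lookup i))
allPairs-lookup (_ ∷ rs) (suc i) (suc j) i≢j = allPairs-lookup rs i j (i≢j ∘ cong suc)

sameEdge-sym : ∀ {n} {e f : Fin n × Fin n} → SameEdge e f → SameEdge f e
sameEdge-sym (inj₁ (a , b)) = inj₁ (sym a , sym b)
sameEdge-sym (inj₂ (a , b)) = inj₂ (sym b , sym a)

ClosedNbhd : (G : Graph) → Fin (V G) → Fin (V G) → Set
ClosedNbhd G u v = v ≡ u ⊎ Adj G u v

adj-sym : ∀ {G u v} → Adj G u v → Adj G v u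
adj-sym (inj₁ uv) = inj₂ uv
adj-sym (inj₂ vu) = inj₁ vu

adj? : (G : Graph) → ∀ u v → Dec (Adj G u v)
adj? G u v = ((u , v) ∈? E G) ⊎-dec ((v , u) ∈? E G)
  where open DecMembership (≡-dec _≟ᶠ_ _≟ᶠ_)

module Edges (G : Graph) where

  src tgt : Fin (numEdges G) → Fin (V G)
  src j = proj₁ (lookup (E G) j)
  tgt j = proj₂ (lookup (E G) j)

  Endpoint : Fin (V G) → Fin (numEdges G) → Set
  Endpoint x j = x ≡ src j ⊎ x ≡ tgt j

  endpoint? : ∀ x j → Dec (Endpoint x j)
  endpoint? x j = (x ≟ᶠ src j) ⊎-dec (x ≟ᶠ tgt j)

  adj⇒edge : ∀ {x y} → Adj G x y → ∃[ j ] Endpoint x j × Endpoint y j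
  adj⇒edge (inj₁ xy) = index xy , inj₁ (cong proj₁ (lookup-index xy)) , inj₂ (cong proj₂ (lookup-index xy))
  adj⇒edge (inj₂ yx) = index yx , inj₂ (cong proj₂ (lookup-index yx)) , inj₁ (cong proj₁ (lookup-index yx))

  endpoints-sameEdge : ∀ {x y j} → x ≢ y → Endpoint x j → Endpoint y j → SameEdge (x , y) (lookup (E G) j)
  endpoints-sameEdge x≢y (inj₁ x≡) (inj₁ y≡) = ⊥-elim (x≢y (trans x≡ (sym y≡)))
  endpoints-sameEdge x≢y (inj₁ x≡) (inj₂ y≡) = inj₁ (x≡ , y≡)
  endpoints-sameEdge x≢y (inj₂ x≡) (inj₁ y≡) = inj₂ (x≡ , y≡)
  endpoints-sameEdge x≢y (inj₂ x≡) (inj₂ y≡) = ⊥-elim (x≢y (trans x≡ (sym y≡)))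

  endpoints-exhaust : ∀ {P : Fin (V G) → Set} {y z j} → y ≢ z → Endpoint y j → Endpoint z j →
                      P y → P z → P (src j) × P (tgt j)
  endpoints-exhaust _   (inj₁ refl) (inj₂ refl) py pz = py , pz
  endpoints-exhaust _   (inj₂ refl) (inj₁ refl) py pz = pz , py
  endpoints-exhaust y≢z (inj₁ refl) (inj₁ z≡)   _  _  = ⊥-elim (y≢z (sym z≡))
  endpoints-exhaust y≢z (inj₂ refl) (inj₂ z≡)   _  _  = ⊥-elim (y≢z (sym z≡))

  module _ (simple : Simple G) where

    loopless : ∀ j → src j ≢ tgt j
    loopless j = All.lookup (proj₁ simple) (∈-lookup j)

    sameEdge⇒≡ : ∀ j j' → SameEdge (lookup (E G) j) (lookup (E G) j') → j ≡ j'
    sameEdge⇒≡ j j' same with j ≟ᶠ j'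
    ... | yes j≡j' = j≡j'
    ... | no j≢j' with allPairs-lookup (proj₂ simple) j j' j≢j'
    ...   | inj₁ notSame = ⊥-elim (notSame same)
    ...   | inj₂ notSame = ⊥-elim (notSame (sameEdge-sym same))

Used : ∀ {n t} → (Fin n → Fin t) → Fin t → Set
Used c i = ∃[ v ] c v ≡ i

used? : ∀ {n t} (c : Fin n → Fin t) i → Dec (Used c i)
used? c i = any? (λ v → c v ≟ᶠ i)

record IsPartialDomColoring (G : Graph) {t : ℕ} (c : Fin (V G) → Fin t) (Req : Pred (Fin (V G)) _) : Set where
  field
    proper        : ∀ u v → Adj G u v → c u ≢ c v
    dominatesUsed : ∀ u → Req u → ∃[ i ] Used c i × Dominates G c u i
    usedDominated : ∀ i → Used c i → ∃[ u ] Dominates G c u i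
open IsPartialDomColoring public

module _ {G : Graph} {t : ℕ} {c : Fin (V G) → Fin t} where

  isDomColoring⇒isPartial : IsDomColoring G t c → IsPartialDomColoring G c U
  isDomColoring⇒isPartial (pr , nonempty , dom , dominated) = record
    { proper        = pr
    ; dominatesUsed = λ u _ → let (i , d) = dom u in i , nonempty i , d
    ; usedDominated = λ i _ → dominated i }

  weakenRequired : ∀ {P Q} → Q ⊆ P → IsPartialDomColoring G c P → IsPartialDomColoring G c Q
  weakenRequired Q⊆P W = record
    { proper        = proper W
    ; dominatesUsed = λ u q → dominatesUsed W u (Q⊆P q)
    ; usedDominated = usedDominated W }

  addRequired : ∀ {P Q} → (∀ u → Q u → ∃[ i ] Used c i × Dominates G c u i) →
                IsPartialDomColoring G c P → IsPartialDomColoring G c (Q ∪ P)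
  addRequired dom W = record
    { proper        = proper W
    ; dominatesUsed = λ { u (inj₁ q) → dom u q ; u (inj₂ p) → dominatesUsed W u p }
    ; usedDominated = usedDominated W }

-- Splitting colour classes preserves everything: sub-classes of dominated classes are dominated.
refine : ∀ {G t t'} {c : Fin (V G) → Fin t} {c' : Fin (V G) → Fin t'} {P} →
         (∀ x y → c' x ≡ c' y → c x ≡ c y) →
         IsPartialDomColoring G c P → IsPartialDomColoring G c' P
refine {G} {c = c} {c'} finer W = record
  { proper        = λ u v a eq → proper W u v a (finer u v eq)
  ; dominatesUsed = λ u p → let (i , (v , cv≡i) , d) = dominatesUsed W u p
                            in c' v , (v , refl) , shrink u v i cv≡i d
  ; usedDominated = λ { i (v , refl) → let (u , d) = usedDominated W (c v) (v , refl)
                                       in u , shrink u v (c v) refl d } }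
  where
    shrink : ∀ u v i → c v ≡ i → Dominates G c u i → Dominates G c' u (c' v)
    shrink u v i refl d w eq = d w (finer w v eq)

relabel : ∀ {G t t'} {c : Fin (V G) → Fin t} {P} (h : Fin t → Fin t') →
          (∀ x y → h x ≡ h y → x ≡ y) →
          IsPartialDomColoring G c P → IsPartialDomColoring G (h ∘ c) P
relabel h h-injective = refine (λ x y → h-injective _ _)

dropUnusedColours : ∀ {G t} {c : Fin (V G) → Fin t} → IsPartialDomColoring G c U →
                    ∃[ s ] s ≤ t × HasDomColoring G s
dropUnusedColours {G} {t} {c} W with all? (used? c)
... | yes allUsed = t , ≤-refl , c , proper W , allUsed
    , (λ u → let (i , _ , d) = dominatesUsed W u tt in i , d)
    , (λ i → usedDominated W i (allUsed i))
dropUnusedColours {t = zero}  W | no notAll = ⊥-elim (notAll λ ())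
dropUnusedColours {t = suc t} {c} W | no notAll with ¬∀⟶∃¬ (suc t) (Used c) (used? c) notAll
... | e , unused = let (s , s≤t , dc) = dropUnusedColours (refine finer W) in s , m≤n⇒m≤1+n s≤t , dc
  where
    c' : _ → Fin t
    c' v = punchOut {i = e} {j = c v} (λ eq → unused (v , sym eq))
    finer : ∀ x y → c' x ≡ c' y → c x ≡ c y
    finer x y = punchOut-injective {i = e} _ _

update : ∀ {n} {A : Set} → (Fin n → A) → Fin n → A → Fin n → A
update f p a v with v ≟ᶠ p
... | yes _ = a
... | no  _ = f v

update-same : ∀ {n} {A : Set} (f : Fin n → A) p a → update f p a p ≡ a
update-same f p a with p ≟ᶠ p
... | yes _   = refl
... | no p≢p = ⊥-elim (p≢p refl)

update-other : ∀ {n} {A : Set} (f : Fin n → A) p a v → v ≢ p → update f p a v ≡ f v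
update-other f p a v v≢p with v ≟ᶠ p
... | yes v≡p = ⊥-elim (v≢p v≡p)
... | no  _   = refl

-- Giving p a colour κ nobody uses makes {p} a class, which p dominates.
module Recolour {G : Graph} {t : ℕ} (c : Fin (V G) → Fin t) (p : Fin (V G)) (κ : Fin t)
                (unused : ¬ Used c κ) where

  recoloured : Fin (V G) → Fin t
  recoloured = update c p κ

  recoloured-κ : ∀ v → recoloured v ≡ κ → v ≡ p
  recoloured-κ v eq with v ≟ᶠ p
  ... | yes v≡p = v≡p
  ... | no  _   = ⊥-elim (unused (v , eq))

  recoloured-≢κ : ∀ v i → recoloured v ≡ i → i ≢ κ → c v ≡ i
  recoloured-≢κ v i eq i≢κ with v ≟ᶠ p
  ... | yes _ = ⊥-elim (i≢κ (sym eq))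
  ... | no  _ = eq

  finer : ∀ x y → recoloured x ≡ recoloured y → c x ≡ c y
  finer x y eq with x ≟ᶠ p | y ≟ᶠ p
  ... | yes refl | yes refl = refl
  ... | yes _    | no  _    = ⊥-elim (unused (y , sym eq))
  ... | no  _    | yes _    = ⊥-elim (unused (x , eq))
  ... | no  _    | no  _    = eq

  recolour : ∀ {P} → IsPartialDomColoring G c P →
             IsPartialDomColoring G recoloured ((_≡ p) ∪ P)
  recolour W = addRequired dominatesSingleton (refine finer W)
    where
      dominatesSingleton : ∀ u → u ≡ p → ∃[ i ] Used recoloured i × Dominates G recoloured u i
      dominatesSingleton u refl = κ , (u , update-same c p κ) , λ v eq → inj₁ (recoloured-κ v eq)

record InducedEmbedding (G H : Graph) : Set where
  field
    embed     : Fin (V G) → Fin (V H)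
    injective : ∀ p q → embed p ≡ embed q → p ≡ q
    adj⁺      : ∀ p q → Adj G p q → Adj H (embed p) (embed q)
    adj⁻      : ∀ p q → Adj H (embed p) (embed q) → Adj G p q
    -- makes classes dominated in H stay dominated after restriction to G
    nbhdTrace : ∀ z → ∃[ p ] ∀ q → ClosedNbhd H z (embed q) → ClosedNbhd G p q

module Restriction {G H : Graph} (ι : InducedEmbedding G H) {t : ℕ} {φ : Fin (V H) → Fin t}
                   (W : IsPartialDomColoring H φ U) where
  open InducedEmbedding ι

  restricted : Fin (V G) → Fin t
  restricted = φ ∘ embed

  κ : Fin (V G) → Fin t
  κ p = proj₁ (dominatesUsed W (embed p) tt)

  κ-used : ∀ p → Used φ (κ p)
  κ-used p = proj₁ (proj₂ (dominatesUsed W (embed p) tt))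

  κ-dominated : ∀ p → Dominates H φ (embed p) (κ p)
  κ-dominated p = proj₂ (proj₂ (dominatesUsed W (embed p) tt))

  restrict : IsPartialDomColoring G restricted (λ p → Used restricted (κ p))
  restrict = record
    { proper        = λ u v a → proper W (embed u) (embed v) (adj⁺ u v a)
    ; dominatesUsed = λ p used → κ p , used , dominated p
    ; usedDominated = λ { i (p , eq) → let (z , d) = usedDominated W i (embed p , eq)
                                           (p' , trace) = nbhdTrace z
                                       in p' , λ q eq' → trace q (d (embed q) eq') } }
    where
      dominated : ∀ p → Dominates G restricted p (κ p)
      dominated p q eq with κ-dominated p (embed q) eq
      ... | inj₁ e = inj₁ (injective q p e)
      ... | inj₂ a = inj₂ (adj⁻ p q a)

  κ-usedIfNbhdInside : ∀ p → (∀ z → ClosedNbhd H (embed p) z → ∃[ q ] embed q ≡ z) →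
                       Used restricted (κ p)
  κ-usedIfNbhdInside p inside with κ-used p
  ... | z , φz≡κ with inside z (κ-dominated p z φz≡κ)
  ... | q , refl = q , φz≡κ

-- H is partitioned into the pieces Gr j (identified through e and its inverse home);
-- pieces coloured from disjoint palettes combine into a colouring of H.
module Glue (H : Graph) (J : ℕ) (Gr : Fin J → Graph)
  (e : (j : Fin J) → Fin (V (Gr j)) → Fin (V H))
  (home : Fin (V H) → Σ (Fin J) (λ j → Fin (V (Gr j))))
  (e∘home : ∀ z → e (proj₁ (home z)) (proj₂ (home z)) ≡ z)
  (home∘e : ∀ j p → home (e j p) ≡ (j , p))
  (adj⁺ : ∀ j p q → Adj (Gr j) p q → Adj H (e j p) (e j q))
  (adj⁻ : ∀ j p q → Adj H (e j p) (e j q) → Adj (Gr j) p q)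
  {t : ℕ} (col : (j : Fin J) → Fin (V (Gr j)) → Fin t)
  (W : ∀ j → IsPartialDomColoring (Gr j) (col j) U)
  (disjoint : ∀ j j' p q → col j p ≡ col j' q → j ≡ j') where

  glued : Fin (V H) → Fin t
  glued z = col (proj₁ (home z)) (proj₂ (home z))

  glued-e : ∀ j p → glued (e j p) ≡ col j p
  glued-e j p = cong (λ h → col (proj₁ h) (proj₂ h)) (home∘e j p)

  classInPiece : ∀ y j i → glued y ≡ i → Used (col j) i → ∃[ q ] y ≡ e j q × col j q ≡ i
  classInPiece y j i eq (w , colw≡i) = inPiece (home y) (e∘home y) eq
    where
      inPiece : (h : Σ (Fin J) (λ j → Fin (V (Gr j)))) → e (proj₁ h) (proj₂ h) ≡ y →
                col (proj₁ h) (proj₂ h) ≡ i → ∃[ q ] y ≡ e j q × col j q ≡ i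
      inPiece (j' , q) eq' colq≡i with disjoint j' j q w (trans colq≡i (sym colw≡i))
      ... | refl = q , sym eq' , colq≡i

  dominates⁺ : ∀ j p i → Used (col j) i → Dominates (Gr j) (col j) p i → Dominates H glued (e j p) i
  dominates⁺ j p i used d y eq with classInPiece y j i eq used
  ... | q , refl , colq≡i with d q colq≡i
  ... | inj₁ refl = inj₁ refl
  ... | inj₂ a = inj₂ (adj⁺ j p q a)

  glue : IsPartialDomColoring H glued U
  glue = record { proper = proper′ ; dominatesUsed = dominatesUsed′ ; usedDominated = usedDominated′ }
    where
      dominatesUsed′ : ∀ z → U z → ∃[ i ] Used glued i × Dominates H glued z i
      dominatesUsed′ z _ with dominatesUsed (W (proj₁ (home z))) (proj₂ (home z)) tt
      ... | i , (w , colw≡i) , d =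
        i , (e _ w , trans (glued-e _ w) colw≡i) ,
        subst (λ z' → Dominates H glued z' i) (e∘home z)
          (dominates⁺ _ _ i (w , colw≡i) d)
      usedDominated′ : ∀ i → Used glued i → ∃[ u ] Dominates H glued u i
      usedDominated′ i (y , eq) with usedDominated (W (proj₁ (home y))) i (proj₂ (home y) , eq)
      ... | p , d = e _ p , dominates⁺ _ p i (proj₂ (home y) , eq) d
      proper′ : ∀ u v → Adj H u v → glued u ≢ glued v
      proper′ u v a eq with classInPiece v (proj₁ (home u)) (glued u) (sym eq) (proj₂ (home u) , refl)
      ... | q , refl , colq≡ =
        proper (W (proj₁ (home u))) (proj₂ (home u)) q
          (adj⁻ _ _ q (subst (λ u' → Adj H u' (e _ q)) (sym (e∘home u)) a))
          (sym colq≡)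

PathStep : ∀ {n} → Fin (suc n) → Fin (suc n) → Set
PathStep {n} p q = ∃[ i ] p ≡ inject₁ {n} i × q ≡ suc i

pathEdge⁻ : ∀ {n} {p q : Fin (suc n)} → (p , q) ∈ E (pathGraph (suc n)) → PathStep p q
pathEdge⁻ pq with ∈-map⁻ _ pq
... | i , _ , refl = i , refl , refl

pathEdge⁺ : ∀ {n} {p q : Fin (suc n)} → PathStep p q → (p , q) ∈ E (pathGraph (suc n))
pathEdge⁺ (i , refl , refl) = ∈-map⁺ _ (∈-allFin i)

pathAdj⁻ : ∀ {n} {p q : Fin (suc n)} → Adj (pathGraph (suc n)) p q → PathStep p q ⊎ PathStep q p
pathAdj⁻ = Sum.map pathEdge⁻ pathEdge⁻

pathAdj⁺ : ∀ {n} {p q : Fin (suc n)} → PathStep p q ⊎ PathStep q p → Adj (pathGraph (suc n)) p q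
pathAdj⁺ = Sum.map pathEdge⁺ pathEdge⁺

pathAdj-step : ∀ {n n'} {p q : Fin (suc n)} {p' q' : Fin (suc n')} →
               (PathStep p q → PathStep p' q') → (PathStep q p → PathStep q' p') →
               Adj (pathGraph (suc n)) p q → Adj (pathGraph (suc n')) p' q'
pathAdj-step f g = pathAdj⁺ ∘ Sum.map f g ∘ pathAdj⁻

module _ {n : ℕ} where

  private
    P P⁺ : Graph
    P  = pathGraph (suc n)
    P⁺ = pathGraph (suc (suc n))

  step-inject₁ : ∀ {p q : Fin (suc n)} → PathStep p q → PathStep (inject₁ p) (inject₁ q)
  step-inject₁ (i , refl , refl) = inject₁ i , refl , refl

  step-inject₁⁻ : ∀ {p q : Fin (suc n)} → PathStep (inject₁ p) (inject₁ q) → PathStep p q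
  step-inject₁⁻ {p} {suc q} (i , p≡i , q≡i) with suc-injective q≡i
  ... | refl = q , inject₁-injective p≡i , refl

  step-suc : ∀ {p q : Fin (suc n)} → PathStep p q → PathStep {suc n} (suc p) (suc q)
  step-suc (i , refl , refl) = suc i , refl , refl

  step-suc⁻ : ∀ {p q : Fin (suc n)} → PathStep {suc n} (suc p) (suc q) → PathStep p q
  step-suc⁻ (suc i , p≡i , q≡i) = i , suc-injective p≡i , suc-injective q≡i

  pathAdj-inject₁ : ∀ p q → Adj P p q → Adj P⁺ (inject₁ p) (inject₁ q)
  pathAdj-inject₁ p q = pathAdj-step step-inject₁ step-inject₁

  pathAdj-inject₁⁻ : ∀ p q → Adj P⁺ (inject₁ p) (inject₁ q) → Adj P p q
  pathAdj-inject₁⁻ p q = pathAdj-step step-inject₁⁻ step-inject₁⁻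

  pathAdj-suc : ∀ p q → Adj P p q → Adj P⁺ (suc p) (suc q)
  pathAdj-suc p q = pathAdj-step step-suc step-suc

  pathAdj-suc⁻ : ∀ p q → Adj P⁺ (suc p) (suc q) → Adj P p q
  pathAdj-suc⁻ p q = pathAdj-step step-suc⁻ step-suc⁻

  pathAdj-fromℕ : ∀ q → Adj P⁺ (fromℕ (suc n)) (inject₁ q) → q ≡ fromℕ n
  pathAdj-fromℕ q a with pathAdj⁻ a
  ... | inj₁ (i , last≡i , _) = ⊥-elim (fromℕ≢inject₁ last≡i)
  ... | inj₂ (i , q≡i , last≡i) with suc-injective last≡i
  ... | refl = inject₁-injective q≡i

  inject₁-embedding : InducedEmbedding (P) P⁺
  inject₁-embedding = record
    { embed     = inject₁
    ; injective = λ _ _ → inject₁-injective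
    ; adj⁺      = pathAdj-inject₁
    ; adj⁻      = pathAdj-inject₁⁻
    ; nbhdTrace = trace }
    where
      trace : ∀ z → ∃[ p ] ∀ q → ClosedNbhd P⁺ z (inject₁ q) → ClosedNbhd (P) p q
      trace z with view z
      ... | ‵fromℕ = fromℕ n , λ where
        q (inj₁ q≡last) → ⊥-elim (fromℕ≢inject₁ (sym q≡last))
        q (inj₂ a)      → inj₁ (pathAdj-fromℕ q a)
      ... | ‵inj₁ {i = p} _ = p , λ where
        q (inj₁ q≡p) → inj₁ (inject₁-injective q≡p)
        q (inj₂ a)   → inj₂ (pathAdj-inject₁⁻ p q a)

  shortenPath : ∀ {t} {g : Fin (suc (suc n)) → Fin t} → IsPartialDomColoring P⁺ g U →
                ∃[ h ] IsPartialDomColoring P h U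
  shortenPath W = shorten (used? restricted (κ (fromℕ n)))
    where
      open Restriction inject₁-embedding W

      Good : Fin (suc n) → Set
      Good p = Used restricted (κ p)

      good-inject₁ : ∀ s → Good (inject₁ s)
      good-inject₁ s = κ-usedIfNbhdInside (inject₁ s) inside
        where
          inside : ∀ z → ClosedNbhd P⁺ (inject₁ (inject₁ s)) z → ∃[ q ] inject₁ q ≡ z
          inside z z∈N with view z
          ... | ‵inj₁ {i = q} _ = q , refl
          ... | ‵fromℕ with z∈N
          ...   | inj₁ last≡s = ⊥-elim (fromℕ≢inject₁ last≡s)
          ...   | inj₂ a = ⊥-elim (fromℕ≢inject₁ (sym (pathAdj-fromℕ (inject₁ s) (adj-sym a))))

      everywhere : ∀ {Q : Fin (suc n) → Set} → Good ⊆ Q → Q (fromℕ n) → ∀ p → Q p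
      everywhere good⊆Q q-last p with view p
      ... | ‵fromℕ          = q-last
      ... | ‵inj₁ {i = s} _ = good⊆Q (good-inject₁ s)

      shorten : Dec (Good (fromℕ n)) → ∃[ h ] IsPartialDomColoring P h U
      shorten (yes good) = restricted , weakenRequired (λ {p} _ → everywhere (λ g → g) good p) restrict
      shorten (no ¬good) = recoloured , weakenRequired (λ {p} _ → everywhere {(_≡ fromℕ n) ∪ Good} inj₂ (inj₁ refl) p)
                                                   (recolour restrict)
        where open Recolour restricted (fromℕ n) (κ (fromℕ n)) ¬good

↑ˡ≢↑ʳ : ∀ {m n} (i : Fin m) (j : Fin n) → i ↑ˡ n ≢ m ↑ʳ j
↑ˡ≢↑ʳ {m} {n} i j eq with trans (sym (splitAt-↑ˡ m i n)) (trans (cong (splitAt m) eq) (splitAt-↑ʳ m n j))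
... | ()

consecPairs-tabulate : ∀ {A : Set} {n} (f : Fin (suc n) → A) →
  consecPairs (tabulate f) ≡ tabulate (λ t → f (inject₁ t) , f (suc t))
consecPairs-tabulate {n = zero}  f = refl
consecPairs-tabulate {n = suc n} f = cong ((f zero , f (suc zero)) ∷_) (consecPairs-tabulate (λ t → f (suc t)))

snoc : ∀ {A : Set} {n} → (Fin n → A) → A → Fin (suc n) → A
snoc {n = zero}  f a _       = a
snoc {n = suc n} f a zero    = f zero
snoc {n = suc n} f a (suc i) = snoc (λ t → f (suc t)) a i

tabulate-snoc : ∀ {A : Set} {n} (f : Fin n → A) a → tabulate (snoc f a) ≡ tabulate f ++ [ a ]
tabulate-snoc {n = zero}  f a = refl
tabulate-snoc {n = suc n} f a = cong (f zero ∷_) (tabulate-snoc (λ t → f (suc t)) a)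

snoc-inject₁ : ∀ {A : Set} {n} (f : Fin n → A) a i → snoc f a (inject₁ i) ≡ f i
snoc-inject₁ {n = suc n} f a zero    = refl
snoc-inject₁ {n = suc n} f a (suc i) = snoc-inject₁ (λ t → f (suc t)) a i

snoc-fromℕ : ∀ {A : Set} {n} (f : Fin n → A) a → snoc f a (fromℕ n) ≡ a
snoc-fromℕ {n = zero}  f a = refl
snoc-fromℕ {n = suc n} f a = snoc-fromℕ (λ t → f (suc t)) a

Chain : ℕ → Graph
Chain r = pathGraph (suc (suc (suc r)))

mid : ∀ {r} → Fin (suc r) → Fin (suc (suc (suc r)))
mid t = suc (inject₁ t)

last : ∀ {r} → Fin (suc (suc (suc r)))
last {r} = suc (fromℕ (suc r))

data Position {r : ℕ} : Fin (suc (suc (suc r))) → Set where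
  first  : Position zero
  middle : ∀ t → Position (mid t)
  final  : Position last

position : ∀ {r} (p : Fin (suc (suc (suc r)))) → Position p
position zero = first
position (suc p) with view p
... | ‵fromℕ          = final
... | ‵inj₁ {i = t} _ = middle t

-- The subdivision S_k(G) for k = r + 2; edge j becomes the copy  chain j  of P_{k+1}.
module Subdivision (G : Graph) (r : ℕ) where

  m : ℕ
  m = numEdges G

  S : Graph
  S = subdivision (suc (suc r)) G

  orig : Fin (V G) → Fin (V S)
  orig x = x ↑ˡ (m * suc r)

  inner : Fin m → Fin (suc r) → Fin (V S)
  inner j t = V G ↑ʳ combine j t

  open Edges G public

  chain : Fin m → Fin (suc (suc (suc r))) → Fin (V S)
  chain j zero    = orig (src j)
  chain j (suc p) = snoc (inner j) (orig (tgt j)) p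

  chain-mid : ∀ j t → chain j (mid t) ≡ inner j t
  chain-mid j t = snoc-inject₁ (inner j) (orig (tgt j)) t

  chain-last : ∀ j → chain j last ≡ orig (tgt j)
  chain-last j = snoc-fromℕ (inner j) (orig (tgt j))

  edges-chain : ∀ j → consecPairs (orig (src j) ∷ (map (inner j) (allFin (suc r)) ++ [ orig (tgt j) ]))
                    ≡ tabulate (λ t → chain j (inject₁ t) , chain j (suc t))
  edges-chain j = begin
    consecPairs (orig (src j) ∷ (map (inner j) (allFin (suc r)) ++ [ orig (tgt j) ]))
      ≡⟨ cong (λ l → consecPairs (orig (src j) ∷ (l ++ [ orig (tgt j) ]))) (map-tabulate (λ t → t) (inner j)) ⟩
    consecPairs (orig (src j) ∷ (tabulate (inner j) ++ [ orig (tgt j) ]))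
      ≡⟨ cong (λ l → consecPairs (orig (src j) ∷ l)) (sym (tabulate-snoc (inner j) (orig (tgt j)))) ⟩
    consecPairs (tabulate (chain j))
      ≡⟨ consecPairs-tabulate (chain j) ⟩
    tabulate (λ t → chain j (inject₁ t) , chain j (suc t)) ∎
    where open ≡-Reasoning

  SubdivStep : Fin (V S) → Fin (V S) → Set
  SubdivStep z z' = ∃[ j ] ∃[ t ] z ≡ chain j (inject₁ t) × z' ≡ chain j (suc t)

  subdivEdge⁻ : ∀ {z z'} → (z , z') ∈ E S → SubdivStep z z'
  subdivEdge⁻ {z} {z'} zz' with satisfied (∈-concatMap⁻ _ {xs = allFin m} zz')
  ... | j , zz'∈j with ∈-tabulate⁻ (subst ((z , z') ∈_) (edges-chain j) zz'∈j)
  ... | t , eq = j , t , cong proj₁ eq , cong proj₂ eq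

  subdivEdge⁺ : ∀ j t → (chain j (inject₁ t) , chain j (suc t)) ∈ E S
  subdivEdge⁺ j t = ∈-concatMap⁺ _ {xs = allFin m}
    (Any.map (λ { refl → subst (step t ∈_) (sym (edges-chain j)) (∈-tabulate⁺ {f = step} t) }) (∈-allFin j))
    where
      step : Fin (suc (suc r)) → Fin (V S) × Fin (V S)
      step t = chain j (inject₁ t) , chain j (suc t)

  subdivAdj⁻ : ∀ {z z'} → Adj S z z' → SubdivStep z z' ⊎ SubdivStep z' z
  subdivAdj⁻ (inj₁ zz') = inj₁ (subdivEdge⁻ zz')
  subdivAdj⁻ (inj₂ z'z) = inj₂ (subdivEdge⁻ z'z)

  orig-injective : ∀ {x y} → orig x ≡ orig y → x ≡ y
  orig-injective = ↑ˡ-injective _ _ _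

  inner-injective : ∀ {j j' t t'} → inner j t ≡ inner j' t' → j ≡ j' × t ≡ t'
  inner-injective eq = combine-injective _ _ _ _ (↑ʳ-injective (V G) _ _ eq)

  orig≢inner : ∀ {x j t} → orig x ≢ inner j t
  orig≢inner = ↑ˡ≢↑ʳ _ _

  chain≡inner : ∀ {j p j' t} → chain j p ≡ inner j' t → j ≡ j' × p ≡ mid t
  chain≡inner {j} {p} eq with position p
  ... | first = ⊥-elim (orig≢inner eq)
  ... | final = ⊥-elim (orig≢inner (trans (sym (chain-last j)) eq))
  ... | middle t' with inner-injective (trans (sym (chain-mid j t')) eq)
  ... | refl , refl = refl , refl

  chain-mid-unique : ∀ {j t j' p'} → chain j (mid t) ≡ chain j' p' → j ≡ j' × p' ≡ mid t
  chain-mid-unique {j} {t} {j'} {p'} eq with chain≡inner {j'} {p'} (trans (sym eq) (chain-mid j t))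
  ... | refl , p'≡ = refl , p'≡

  chain≡orig : ∀ {j p x} → chain j p ≡ orig x → (p ≡ zero × x ≡ src j) ⊎ (p ≡ last × x ≡ tgt j)
  chain≡orig {j} {p} eq with position p
  ... | first    = inj₁ (refl , orig-injective (sym eq))
  ... | final    = inj₂ (refl , orig-injective (trans (sym eq) (chain-last j)))
  ... | middle t = ⊥-elim (orig≢inner (trans (sym eq) (chain-mid j t)))

  chain-injective : ∀ {j} → src j ≢ tgt j → ∀ p q → chain j p ≡ chain j q → p ≡ q
  chain-injective {j} src≢tgt p q eq with position p
  ... | middle t = sym (proj₂ (chain-mid-unique eq))
  ... | first with chain≡orig (sym eq)
  ...   | inj₁ (q≡0 , _)   = sym q≡0
  ...   | inj₂ (_ , src≡tgt) = ⊥-elim (src≢tgt src≡tgt)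
  chain-injective {j} src≢tgt p q eq | final with chain≡orig (trans (sym eq) (chain-last j))
  ...   | inj₁ (_ , tgt≡src) = ⊥-elim (src≢tgt (sym tgt≡src))
  ...   | inj₂ (q≡last , _)  = sym q≡last

  chainAdj⁺ : ∀ j p q → Adj (Chain r) p q → Adj S (chain j p) (chain j q)
  chainAdj⁺ j p q a with pathAdj⁻ a
  ... | inj₁ (t , refl , refl) = inj₁ (subdivEdge⁺ j t)
  ... | inj₂ (t , refl , refl) = inj₂ (subdivEdge⁺ j t)

  -- Every edge of S_k(G) has a middle vertex of a chain as an endpoint, which pins down the chain.
  chainStep⁻ : ∀ {j} → src j ≢ tgt j → ∀ p q → SubdivStep (chain j p) (chain j q) → PathStep p q
  chainStep⁻ {j} src≢tgt p q (j' , zero , p≡ , q≡) with chain-mid-unique {j'} {zero} {j} {q} (sym q≡)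
  ... | refl , refl = zero , chain-injective src≢tgt p zero p≡ , refl
  chainStep⁻ {j} src≢tgt p q (j' , suc s , p≡ , q≡) with chain-mid-unique {j'} {s} {j} {p} (sym p≡)
  ... | refl , refl = suc s , refl , chain-injective src≢tgt q (suc (suc s)) q≡

  chainAdj⁻ : ∀ {j} → src j ≢ tgt j → ∀ p q → Adj S (chain j p) (chain j q) → Adj (Chain r) p q
  chainAdj⁻ src≢tgt p q = pathAdj⁺ ∘ Sum.map (chainStep⁻ src≢tgt p q) (chainStep⁻ src≢tgt q p) ∘ subdivAdj⁻

-- χ_dd(P_{k+1}) ≤ χ_dd(S_k(G)): restrict to the chain of one edge j₀.
module LowerBound (G : Graph) (r : ℕ) (simple : Simple G) (j₀ : Fin (numEdges G)) where
  open Subdivision G r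

  InnerOf : Fin (V S) → Fin m → Set
  InnerOf z j = ∃[ t ] z ≡ chain j (mid t)

  origNeighbour : ∀ {z x} → Adj S z (orig x) → ∃[ j ] Endpoint x j × InnerOf z j
  origNeighbour {x = x} a with subdivAdj⁻ a
  ... | inj₁ (j , t , z≡ , x≡) with chain≡orig {j} {suc t} {x} (sym x≡)
  ...   | inj₂ (suct≡last , x≡tgt) with suc-injective {i = t} suct≡last
  ...     | refl = j , inj₂ x≡tgt , fromℕ r , z≡
  origNeighbour {x = x} a | inj₂ (j , zero , x≡ , z≡) with chain≡orig {j} {zero} {x} (sym x≡)
  ...   | inj₁ (_ , x≡src) = j , inj₁ x≡src , zero , z≡
  ...   | inj₂ (() , _)
  origNeighbour {x = x} a | inj₂ (j , suc t , x≡ , z≡) with chain≡orig {j} {suc (inject₁ t)} {x} (sym x≡)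
  ...   | inj₁ (() , _)
  ...   | inj₂ (inj≡last , _) = ⊥-elim (fromℕ≢inject₁ (sym (suc-injective inj≡last)))

  OnChain : Fin (V S) → Set
  OnChain z = ∃[ p ] chain j₀ p ≡ z

  onChain? : ∀ z → Dec (OnChain z)
  onChain? z = any? (λ p → chain j₀ p ≟ᶠ z)

  -- A common neighbour of both ends would be an inner vertex of a second copy of the edge j₀.
  noCommonNeighbour : ∀ z → ¬ OnChain z → Adj S z (chain j₀ zero) → Adj S z (chain j₀ last) → ⊥
  noCommonNeighbour z off a₀ aₗ
    with origNeighbour a₀ | origNeighbour (subst (Adj S z) (chain-last j₀) aₗ)
  ... | j , src-end , t , z≡ | j' , tgt-end , t' , z≡'
    with chain-mid-unique {j} {t} {j'} {mid t'} (trans (sym z≡) z≡')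
  ... | refl , _ with sameEdge⇒≡ simple j₀ j (endpoints-sameEdge (loopless simple j₀) src-end tgt-end)
  ... | refl = off (mid t , sym z≡)

  chain-mid-nbhd : ∀ j t z → ClosedNbhd S (chain j (mid t)) z → ∃[ q ] chain j q ≡ z
  chain-mid-nbhd j t z (inj₁ z≡) = mid t , sym z≡
  chain-mid-nbhd j t z (inj₂ a) with subdivAdj⁻ a
  ... | inj₁ (j' , s , mid≡ , z≡) with chain-mid-unique {j} {t} {j'} {inject₁ s} mid≡
  ...   | refl , _ = suc s , sym z≡
  chain-mid-nbhd j t z (inj₂ a) | inj₂ (j' , s , z≡ , mid≡) with chain-mid-unique {j} {t} {j'} {suc s} mid≡
  ...   | refl , _ = inject₁ s , sym z≡

  offChainNeighbour : ∀ z q → ¬ OnChain z → Adj S z (chain j₀ q) → q ≡ zero ⊎ q ≡ last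
  offChainNeighbour z q off a with position q
  ... | first    = inj₁ refl
  ... | final    = inj₂ refl
  ... | middle t = ⊥-elim (off (chain-mid-nbhd j₀ t z (inj₂ (adj-sym a))))

  chainEmbedding : InducedEmbedding (Chain r) S
  chainEmbedding = record
    { embed     = chain j₀
    ; injective = chain-injective (loopless simple j₀)
    ; adj⁺      = chainAdj⁺ j₀
    ; adj⁻      = chainAdj⁻ (loopless simple j₀)
    ; nbhdTrace = trace }
    where
      trace : ∀ z → ∃[ p ] ∀ q → ClosedNbhd S z (chain j₀ q) → ClosedNbhd (Chain r) p q
      trace z with onChain? z
      ... | yes (p , refl) = p , λ where
        q (inj₁ q≡p) → inj₁ (chain-injective (loopless simple j₀) q p q≡p)
        q (inj₂ a)   → inj₂ (chainAdj⁻ (loopless simple j₀) p q a)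
      ... | no off with adj? S z (chain j₀ zero)
      ...   | yes a₀ = zero , λ where
        q (inj₁ q≡z) → ⊥-elim (off (q , q≡z))
        q (inj₂ a) → case offChainNeighbour z q off a of λ where
          (inj₁ q≡0)    → inj₁ q≡0
          (inj₂ refl)   → ⊥-elim (noCommonNeighbour z off a₀ a)
      ...   | no ¬a₀ = last , λ where
        q (inj₁ q≡z) → ⊥-elim (off (q , q≡z))
        q (inj₂ a) → case offChainNeighbour z q off a of λ where
          (inj₁ refl)   → ⊥-elim (¬a₀ a)
          (inj₂ q≡last) → inj₁ q≡last

  lower : ∀ {b} → HasDomColoring S b → ∃[ s ] s ≤ b × HasDomColoring (Chain r) s
  lower (φ , isDomColoring) = byEnds (used? restricted (κ zero)) (used? restricted (κ last))
    where
      open Restriction chainEmbedding (isDomColoring⇒isPartial isDomColoring)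

      Good : Fin (suc (suc (suc r))) → Set
      Good p = Used restricted (κ p)

      everywhere : ∀ {Q : Fin (suc (suc (suc r))) → Set} → Good ⊆ Q → Q zero → Q last → ∀ p → Q p
      everywhere good⊆Q q₀ qₗ p with position p
      ... | first    = q₀
      ... | final    = qₗ
      ... | middle t = good⊆Q (κ-usedIfNbhdInside (mid t) (chain-mid-nbhd j₀ t))

      finish : ∀ {t} {c : Fin (suc (suc (suc r))) → Fin t} {Q} →
               IsPartialDomColoring (Chain r) c Q → (∀ p → Q p) → ∃[ s ] s ≤ t × HasDomColoring (Chain r) s
      finish W all = dropUnusedColours (weakenRequired (λ {p} _ → all p) W)

      -- The class of a vertex of S dominated by both ends would have to be on the chain.
      κ-ends-distinct : ¬ Good zero → κ zero ≢ κ last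
      κ-ends-distinct ¬good₀ κ₀≡κₗ with κ-used zero
      ... | z , φz≡κ₀ with onChain? z
      ...   | yes (q , refl) = ¬good₀ (q , φz≡κ₀)
      ...   | no off with κ-dominated zero z φz≡κ₀ | κ-dominated last z (trans φz≡κ₀ κ₀≡κₗ)
      ...     | inj₁ z≡ | _       = off (zero , sym z≡)
      ...     | inj₂ _  | inj₁ z≡ = off (last , sym z≡)
      ...     | inj₂ a₀ | inj₂ aₗ = noCommonNeighbour z off (adj-sym a₀) (adj-sym aₗ)

      byEnds : Dec (Good zero) → Dec (Good last) → ∃[ s ] s ≤ _ × HasDomColoring (Chain r) s
      byEnds (yes good₀) (yes goodₗ) = finish restrict (everywhere (λ g → g) good₀ goodₗ)
      byEnds (no ¬good₀) (yes goodₗ) = finish (recolour restrict) (everywhere inj₂ (inj₁ refl) (inj₂ goodₗ))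
        where open Recolour restricted zero (κ zero) ¬good₀
      byEnds (yes good₀) (no ¬goodₗ) = finish (recolour restrict) (everywhere inj₂ (inj₂ good₀) (inj₁ refl))
        where open Recolour restricted last (κ last) ¬goodₗ
      byEnds (no ¬good₀) (no ¬goodₗ) =
        finish (R₂.recolour (R₁.recolour restrict)) (everywhere (inj₂ ∘ inj₂) (inj₂ (inj₁ refl)) (inj₁ refl))
        where
          module R₁ = Recolour restricted zero (κ zero) ¬good₀
          unusedₗ : ¬ Used R₁.recoloured (κ last)
          unusedₗ (v , eq) = ¬goodₗ (v , R₁.recoloured-≢κ v (κ last) eq (κ-ends-distinct ¬good₀ ∘ sym))
          module R₂ = Recolour R₁.recoloured last (κ last) unusedₗ

-- σ x is the edge through which x is reached in a spanning tree grown from the edge j₀.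
record TreeAssignment (G : Graph) (j₀ : Fin (numEdges G)) : Set where
  open Edges G
  field
    σ         : Fin (V G) → Fin (numEdges G)
    σ-src     : σ (src j₀) ≡ j₀
    σ-tgt     : σ (tgt j₀) ≡ j₀
    endpoint  : ∀ x → Endpoint x (σ x)
    injective : ∀ x y → σ x ≡ σ y → σ x ≢ j₀ → x ≡ y

module TreeConstruction (G : Graph) (connected : Connected G) (j₀ : Fin (numEdges G)) where
  open Edges G

  private
    m = numEdges G
    Partial = Fin (V G) → Maybe (Fin m)

  Covered : Partial → Fin (V G) → Set
  Covered τ x = ∃[ j ] τ x ≡ just j

  covered? : ∀ τ x → Dec (Covered τ x)
  covered? τ x with τ x
  ... | just j  = yes (j , refl)
  ... | nothing = no λ ()

  record PartialTree (τ : Partial) : Set where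
    field
      at-src    : τ (src j₀) ≡ just j₀
      at-tgt    : τ (tgt j₀) ≡ just j₀
      endpoint  : ∀ x j → τ x ≡ just j → Endpoint x j
      injective : ∀ x y j → τ x ≡ just j → τ y ≡ just j → j ≢ j₀ → x ≡ y
      -- so an edge at an uncovered vertex is still unassigned
      closed    : ∀ x j → τ x ≡ just j → Covered τ (src j) × Covered τ (tgt j)
  open PartialTree

  module Grow {τ : Partial} (T : PartialTree τ) {y z : Fin (V G)} (cy : Covered τ y) (¬cz : ¬ Covered τ z)
              {j : Fin m} (y-end : Endpoint y j) (z-end : Endpoint z j) where

    τ′ : Partial
    τ′ = update τ z (just j)

    covered-z : Covered τ′ z
    covered-z = j , update-same τ z (just j)

    ≢z : ∀ w → Covered τ w → w ≢ z
    ≢z w cw refl = ¬cz cw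

    old : ∀ w → Covered τ w → τ′ w ≡ τ w
    old w cw = update-other τ z (just j) w (≢z w cw)

    covered-mono : ∀ w → Covered τ w → Covered τ′ w
    covered-mono w cw@(j' , τw≡) = j' , trans (old w cw) τw≡

    new-or-old : ∀ x j' → τ′ x ≡ just j' → (x ≡ z × j' ≡ j) ⊎ τ x ≡ just j'
    new-or-old x j' eq with x ≟ᶠ z
    ... | yes refl = inj₁ (refl , sym (just-injective eq))
    ... | no  _    = inj₂ eq

    j-fresh : ∀ x → τ x ≢ just j
    j-fresh x eq = ¬cz (endsCovered z-end (closed T x j eq))
      where
        endsCovered : ∀ {w} → Endpoint w j → Covered τ (src j) × Covered τ (tgt j) → Covered τ w
        endsCovered (inj₁ refl) (cs , _) = cs
        endsCovered (inj₂ refl) (_ , ct) = ct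

    grown : PartialTree τ′
    grown = record
      { at-src    = trans (old _ (j₀ , at-src T)) (at-src T)
      ; at-tgt    = trans (old _ (j₀ , at-tgt T)) (at-tgt T)
      ; endpoint  = endpoint′
      ; injective = injective′
      ; closed    = closed′ }
      where
        endpoint′ : ∀ x j' → τ′ x ≡ just j' → Endpoint x j'
        endpoint′ x j' eq with new-or-old x j' eq
        ... | inj₁ (refl , refl) = z-end
        ... | inj₂ eq′ = endpoint T x j' eq′
        injective′ : ∀ x x' j' → τ′ x ≡ just j' → τ′ x' ≡ just j' → j' ≢ j₀ → x ≡ x'
        injective′ x x' j' eq eq' j'≢j₀ with new-or-old x j' eq | new-or-old x' j' eq'
        ... | inj₁ (refl , _)    | inj₁ (refl , _)    = refl
        ... | inj₁ (_ , refl)    | inj₂ old'          = ⊥-elim (j-fresh x' old')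
        ... | inj₂ old           | inj₁ (_ , refl)    = ⊥-elim (j-fresh x old)
        ... | inj₂ old           | inj₂ old'          = injective T x x' j' old old' j'≢j₀
        closed′ : ∀ x j' → τ′ x ≡ just j' → Covered τ′ (src j') × Covered τ′ (tgt j')
        closed′ x j' eq with new-or-old x j' eq
        ... | inj₁ (refl , refl) = endpoints-exhaust (≢z y cy) y-end z-end (covered-mono y cy) covered-z
        ... | inj₂ eq′ = let (cs , ct) = closed T x j' eq′ in covered-mono _ cs , covered-mono _ ct

  record Extension (τ : Partial) (b : Fin (V G)) : Set where
    field
      τ⁺       : Partial
      tree     : PartialTree τ⁺
      covers-b : Covered τ⁺ b
      mono     : ∀ w → Covered τ w → Covered τ⁺ w

  extendAlong : ∀ {τ a b} → PartialTree τ → Covered τ a → Star (Adj G) a b → Extension τ b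
  extendAlong T ca ε = record { τ⁺ = _ ; tree = T ; covers-b = ca ; mono = λ _ c → c }
  extendAlong {τ} T ca (_◅_ {j = w} a-w rest) with covered? τ w
  ... | yes cw = extendAlong T cw rest
  ... | no ¬cw =
    let (j , a-end , w-end) = adj⇒edge a-w
        open Grow T ca ¬cw a-end w-end
        e = extendAlong grown covered-z rest
        open Extension e
    in record { τ⁺ = τ⁺ ; tree = tree ; covers-b = covers-b ; mono = λ v cv → mono v (covered-mono v cv) }

  τ₀ : Partial
  τ₀ x with endpoint? x j₀
  ... | yes _ = just j₀
  ... | no  _ = nothing

  τ₀-just : ∀ {x j} → τ₀ x ≡ just j → j₀ ≡ j × Endpoint x j₀
  τ₀-just {x} eq with endpoint? x j₀
  ... | yes x-end = just-injective eq , x-end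

  τ₀-endpoint : ∀ {x} → Endpoint x j₀ → τ₀ x ≡ just j₀
  τ₀-endpoint {x} x-end with endpoint? x j₀
  ... | yes _    = refl
  ... | no ¬end = ⊥-elim (¬end x-end)

  initial : PartialTree τ₀
  initial = record
    { at-src    = τ₀-endpoint (inj₁ refl)
    ; at-tgt    = τ₀-endpoint (inj₂ refl)
    ; endpoint  = λ { x j eq → case τ₀-just eq of λ { (refl , x-end) → x-end } }
    ; injective = λ x y j eq _ j≢j₀ → ⊥-elim (j≢j₀ (sym (proj₁ (τ₀-just eq))))
    ; closed    = λ { x j eq → case τ₀-just eq of λ { (refl , _) → (j₀ , τ₀-endpoint (inj₁ refl)) , (j₀ , τ₀-endpoint (inj₂ refl)) } } }

  coverAll : (xs : List (Fin (V G))) → ∃[ τ ] PartialTree τ × All (Covered τ) xs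
  coverAll []       = τ₀ , initial , []
  coverAll (x ∷ xs) =
    let (τ , T , cxs) = coverAll xs
        open Extension (extendAlong T (j₀ , at-src T) (connected (src j₀) x))
    in τ⁺ , tree , covers-b ∷ All.map (mono _) cxs

  treeAssignment : TreeAssignment G j₀
  treeAssignment = record
    { σ         = σ
    ; σ-src     = just-injective (trans (sym (proj₂ (cover (src j₀)))) (at-src T))
    ; σ-tgt     = just-injective (trans (sym (proj₂ (cover (tgt j₀)))) (at-tgt T))
    ; endpoint  = λ x → endpoint T x (σ x) (proj₂ (cover x))
    ; injective = λ x y σx≡σy → injective T x y (σ x) (proj₂ (cover x)) (trans (proj₂ (cover y)) (cong just (sym σx≡σy))) }
    where
      τ = proj₁ (coverAll (allFin (V G)))
      T = proj₁ (proj₂ (coverAll (allFin (V G))))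
      cover : ∀ x → Covered τ x
      cover x = All.lookup (proj₂ (proj₂ (coverAll (allFin (V G))))) (∈-allFin x)
      σ : Fin (V G) → Fin m
      σ x = proj₁ (cover x)

-- The ends of its chain that an edge receives under σ; its piece of S_k(G) is its inner
-- vertices together with those ends.
data Shape : Set where
  both srcOnly tgtOnly neither : Shape

data HasSrc : Shape → Set where
  both    : HasSrc both
  srcOnly : HasSrc srcOnly

data HasTgt : Shape → Set where
  both    : HasTgt both
  tgtOnly : HasTgt tgtOnly

module Pieces (r : ℕ) where

  pieceEdges : Shape → ℕ
  pieceEdges both    = suc (suc r)
  pieceEdges srcOnly = suc r
  pieceEdges tgtOnly = suc r
  pieceEdges neither = r

  size : Shape → ℕ
  size s = suc (pieceEdges s)

  emb : (s : Shape) → Fin (size s) → Fin (suc (suc (suc r)))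
  emb both    p = p
  emb srcOnly p = inject₁ p
  emb tgtOnly p = suc p
  emb neither p = mid p

  midPos : (s : Shape) → Fin (suc r) → Fin (size s)
  midPos both    t = mid t
  midPos srcOnly t = suc t
  midPos tgtOnly t = inject₁ t
  midPos neither t = t

  -- srcPos and tgtPos are junk (zero) on shapes not containing that end.
  srcPos tgtPos : (s : Shape) → Fin (size s)
  srcPos both    = zero
  srcPos srcOnly = zero
  srcPos tgtOnly = zero
  srcPos neither = zero
  tgtPos both    = last
  tgtPos srcOnly = zero
  tgtPos tgtOnly = fromℕ (suc r)
  tgtPos neither = zero

  emb-mid : ∀ s t → emb s (midPos s t) ≡ mid t
  emb-mid both    t = refl
  emb-mid srcOnly t = refl
  emb-mid tgtOnly t = refl
  emb-mid neither t = refl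

  emb-src : ∀ {s} → HasSrc s → emb s (srcPos s) ≡ zero
  emb-src both    = refl
  emb-src srcOnly = refl

  emb-tgt : ∀ {s} → HasTgt s → emb s (tgtPos s) ≡ last
  emb-tgt both    = refl
  emb-tgt tgtOnly = refl

  data PiecePosition (s : Shape) : Fin (size s) → Set where
    atSrc : HasSrc s → PiecePosition s (srcPos s)
    atTgt : HasTgt s → PiecePosition s (tgtPos s)
    atMid : ∀ t → PiecePosition s (midPos s t)

  piecePosition : ∀ s p → PiecePosition s p
  piecePosition both p with position p
  ... | first    = atSrc both
  ... | middle t = atMid t
  ... | final    = atTgt both
  piecePosition srcOnly zero    = atSrc srcOnly
  piecePosition srcOnly (suc t) = atMid t
  piecePosition tgtOnly p with view p
  ... | ‵fromℕ          = atTgt tgtOnly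
  ... | ‵inj₁ {i = t} _ = atMid t
  piecePosition neither t = atMid t

  emb-adj⁺ : ∀ s p q → Adj (pathGraph (size s)) p q → Adj (Chain r) (emb s p) (emb s q)
  emb-adj⁺ both    p q a = a
  emb-adj⁺ srcOnly p q a = pathAdj-inject₁ p q a
  emb-adj⁺ tgtOnly p q a = pathAdj-suc p q a
  emb-adj⁺ neither p q a = pathAdj-suc _ _ (pathAdj-inject₁ p q a)

  emb-adj⁻ : ∀ s p q → Adj (Chain r) (emb s p) (emb s q) → Adj (pathGraph (size s)) p q
  emb-adj⁻ both    p q a = a
  emb-adj⁻ srcOnly p q a = pathAdj-inject₁⁻ p q a
  emb-adj⁻ tgtOnly p q a = pathAdj-suc⁻ p q a
  emb-adj⁻ neither p q a = pathAdj-inject₁⁻ p q (pathAdj-suc⁻ _ _ a)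

module UpperBound (V₀ : ℕ) (e₀ : Fin V₀ × Fin V₀) (es : List (Fin V₀ × Fin V₀)) (r : ℕ)
  (simple : Simple (mkGraph V₀ (e₀ ∷ es))) (connected : Connected (mkGraph V₀ (e₀ ∷ es)))
  {a c : ℕ} {f : Fin (suc (suc (suc r))) → Fin a} (Wf : IsPartialDomColoring (Chain r) f U)
  {g : Fin (suc (suc r)) → Fin c} (Wg : IsPartialDomColoring (pathGraph (suc (suc r))) g U) where

  private
    G : Graph
    G = mkGraph V₀ (e₀ ∷ es)

  open Subdivision G r
  open Pieces r
  open ≡-Reasoning
  open TreeAssignment (TreeConstruction.treeAssignment G connected zero)

  m' : ℕ
  m' = length es

  shape : Fin (suc m') → Shape
  shape zero = both
  shape (suc j) with σ (src (suc j)) ≟ᶠ suc j | σ (tgt (suc j)) ≟ᶠ suc j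
  ... | yes _ | _     = srcOnly
  ... | no _  | yes _ = tgtOnly
  ... | no _  | no _  = neither

  not-both : ∀ j → σ (src (suc j)) ≡ suc j → σ (tgt (suc j)) ≡ suc j → ⊥
  not-both j src↦j tgt↦j =
    loopless simple (suc j) (injective _ _ (trans src↦j (sym tgt↦j)) (λ σ≡0 → 0≢1+n (trans (sym σ≡0) src↦j)))

  hasSrc : ∀ j → σ (src j) ≡ j → HasSrc (shape j)
  hasSrc zero    _ = both
  hasSrc (suc j) src↦j with σ (src (suc j)) ≟ᶠ suc j
  ... | yes _ = srcOnly
  ... | no ¬src↦j = ⊥-elim (¬src↦j src↦j)

  hasSrc⁻ : ∀ j → HasSrc (shape j) → σ (src j) ≡ j
  hasSrc⁻ zero    _ = σ-src
  hasSrc⁻ (suc j) h with σ (src (suc j)) ≟ᶠ suc j | σ (tgt (suc j)) ≟ᶠ suc j | h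
  ... | yes src↦j | _ | _ = src↦j
  ... | no _ | yes _ | ()
  ... | no _ | no _  | ()

  hasTgt : ∀ j → σ (tgt j) ≡ j → HasTgt (shape j)
  hasTgt zero    _ = both
  hasTgt (suc j) tgt↦j with σ (src (suc j)) ≟ᶠ suc j | σ (tgt (suc j)) ≟ᶠ suc j
  ... | yes src↦j | _ = ⊥-elim (not-both j src↦j tgt↦j)
  ... | no _ | yes _ = tgtOnly
  ... | no _ | no ¬tgt↦j = ⊥-elim (¬tgt↦j tgt↦j)

  hasTgt⁻ : ∀ j → HasTgt (shape j) → σ (tgt j) ≡ j
  hasTgt⁻ zero    _ = σ-tgt
  hasTgt⁻ (suc j) h with σ (src (suc j)) ≟ᶠ suc j | σ (tgt (suc j)) ≟ᶠ suc j | h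
  ... | yes _ | _ | ()
  ... | no _ | yes tgt↦j | _ = tgt↦j
  ... | no _ | no _  | ()

  shape-suc≢both : ∀ j → shape (suc j) ≢ both
  shape-suc≢both j eq with σ (src (suc j)) ≟ᶠ suc j | σ (tgt (suc j)) ≟ᶠ suc j | eq
  ... | yes _ | _     | ()
  ... | no _  | yes _ | ()
  ... | no _  | no _  | ()

  T : ℕ
  T = m' * c + a

  rootColour : Fin a → Fin T
  rootColour = (m' * c) ↑ʳ_

  edgeColour : Fin m' → Fin c → Fin T
  edgeColour j y = combine j y ↑ˡ a

  edgeColour-injective : ∀ {j j' y y'} → edgeColour j y ≡ edgeColour j' y' → j ≡ j' × y ≡ y'
  edgeColour-injective eq = combine-injective _ _ _ _ (↑ˡ-injective a _ _ eq)

  -- The value on both is junk: only the root edge has that shape.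
  offRootColouring : (s : Shape) → Fin (size s) → Fin c
  offRootColouring both    _ = g zero
  offRootColouring srcOnly   = g
  offRootColouring tgtOnly   = g
  offRootColouring neither   = proj₁ (shortenPath Wg)

  offRootColouring-isPartial : ∀ s → s ≢ both → IsPartialDomColoring (pathGraph (size s)) (offRootColouring s) U
  offRootColouring-isPartial both    ≢both = ⊥-elim (≢both refl)
  offRootColouring-isPartial srcOnly _     = Wg
  offRootColouring-isPartial tgtOnly _     = Wg
  offRootColouring-isPartial neither _     = proj₂ (shortenPath Wg)

  Piece : Fin (suc m') → Graph
  Piece j = pathGraph (size (shape j))

  pieceColouring : (j : Fin (suc m')) → Fin (size (shape j)) → Fin T
  pieceColouring zero    p = rootColour (f p)
  pieceColouring (suc j) p = edgeColour j (offRootColouring (shape (suc j)) p)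

  pieceColouring-isPartial : ∀ j → IsPartialDomColoring (Piece j) (pieceColouring j) U
  pieceColouring-isPartial zero    = relabel rootColour (↑ʳ-injective (m' * c)) Wf
  pieceColouring-isPartial (suc j) = relabel (edgeColour j) (λ _ _ → proj₂ ∘ edgeColour-injective)
                                             (offRootColouring-isPartial _ (shape-suc≢both j))

  palettes-disjoint : ∀ j j' p q → pieceColouring j p ≡ pieceColouring j' q → j ≡ j'
  palettes-disjoint zero    zero     _ _ _  = refl
  palettes-disjoint zero    (suc j') _ _ eq = ⊥-elim (↑ˡ≢↑ʳ _ _ (sym eq))
  palettes-disjoint (suc j) zero     _ _ eq = ⊥-elim (↑ˡ≢↑ʳ _ _ eq)
  palettes-disjoint (suc j) (suc j') _ _ eq = cong suc (proj₁ (edgeColour-injective eq))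

  Place : Set
  Place = Σ (Fin (suc m')) (λ j → Fin (size (shape j)))

  place : Place → Fin (V S)
  place (j , p) = chain j (emb (shape j) p)

  atSrcOf atTgtOf : Fin (suc m') → Place
  atSrcOf j = j , srcPos (shape j)
  atTgtOf j = j , tgtPos (shape j)

  homeOrig : Fin V₀ → Place
  homeOrig x with x ≟ᶠ src (σ x)
  ... | yes _ = atSrcOf (σ x)
  ... | no  _ = atTgtOf (σ x)

  homeInner : Fin (suc m') × Fin (suc r) → Place
  homeInner (j , t) = j , midPos (shape j) t

  home : Fin (V S) → Place
  home z with splitAt V₀ z
  ... | inj₁ x = homeOrig x
  ... | inj₂ w = homeInner (remQuot {suc m'} (suc r) w)

  home-orig : ∀ x → home (orig x) ≡ homeOrig x
  home-orig x rewrite splitAt-↑ˡ V₀ x (suc m' * suc r) = refl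

  home-inner : ∀ j t → home (inner j t) ≡ homeInner (j , t)
  home-inner j t rewrite splitAt-↑ʳ V₀ (suc m' * suc r) (combine j t) = cong homeInner (remQuot-combine j t)

  homeOrig-src : ∀ x → x ≡ src (σ x) → homeOrig x ≡ atSrcOf (σ x)
  homeOrig-src x x≡src with x ≟ᶠ src (σ x)
  ... | yes _ = refl
  ... | no x≢src = ⊥-elim (x≢src x≡src)

  homeOrig-tgt : ∀ x → x ≡ tgt (σ x) → homeOrig x ≡ atTgtOf (σ x)
  homeOrig-tgt x x≡tgt with x ≟ᶠ src (σ x)
  ... | yes x≡src = ⊥-elim (loopless simple (σ x) (trans (sym x≡src) x≡tgt))
  ... | no _ = refl

  place-atSrcOf : ∀ j → HasSrc (shape j) → place (atSrcOf j) ≡ orig (src j)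
  place-atSrcOf j h = cong (chain j) (emb-src h)

  place-atTgtOf : ∀ j → HasTgt (shape j) → place (atTgtOf j) ≡ orig (tgt j)
  place-atTgtOf j h = trans (cong (chain j) (emb-tgt h)) (chain-last j)

  place-homeOrig : ∀ x → place (homeOrig x) ≡ orig x
  place-homeOrig x with endpoint x
  ... | inj₁ x≡src = begin
    place (homeOrig x)      ≡⟨ cong place (homeOrig-src x x≡src) ⟩
    place (atSrcOf (σ x))   ≡⟨ place-atSrcOf (σ x) (hasSrc (σ x) (cong σ (sym x≡src))) ⟩
    orig (src (σ x))        ≡⟨ cong orig (sym x≡src) ⟩
    orig x                  ∎
  ... | inj₂ x≡tgt = begin
    place (homeOrig x)      ≡⟨ cong place (homeOrig-tgt x x≡tgt) ⟩
    place (atTgtOf (σ x))   ≡⟨ place-atTgtOf (σ x) (hasTgt (σ x) (cong σ (sym x≡tgt))) ⟩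
    orig (tgt (σ x))        ≡⟨ cong orig (sym x≡tgt) ⟩
    orig x                  ∎

  place-homeInner : ∀ j t → place (homeInner (j , t)) ≡ inner j t
  place-homeInner j t = trans (cong (chain j) (emb-mid (shape j) t)) (chain-mid j t)

  place∘home : ∀ z → place (home z) ≡ z
  place∘home z with splitAt V₀ z in eq
  ... | inj₁ x = trans (place-homeOrig x) (splitAt⁻¹-↑ˡ eq)
  ... | inj₂ w = let (j , t) = remQuot {suc m'} (suc r) w in begin
    place (homeInner (remQuot {suc m'} (suc r) w)) ≡⟨ place-homeInner j t ⟩
    V₀ ↑ʳ uncurry combine (remQuot {suc m'} (suc r) w) ≡⟨ cong (V₀ ↑ʳ_) (combine-remQuot {suc m'} (suc r) w) ⟩
    V₀ ↑ʳ w                                 ≡⟨ splitAt⁻¹-↑ʳ eq ⟩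
    z                                       ∎

  home∘place : ∀ j p → home (place (j , p)) ≡ (j , p)
  home∘place j p with piecePosition (shape j) p
  ... | atSrc h = begin
    home (place (atSrcOf j))     ≡⟨ cong home (place-atSrcOf j h) ⟩
    home (orig (src j))          ≡⟨ home-orig (src j) ⟩
    homeOrig (src j)             ≡⟨ homeOrig-src (src j) (cong src (sym (hasSrc⁻ j h))) ⟩
    atSrcOf (σ (src j))          ≡⟨ cong atSrcOf (hasSrc⁻ j h) ⟩
    atSrcOf j                    ∎
  ... | atTgt h = begin
    home (place (atTgtOf j))     ≡⟨ cong home (place-atTgtOf j h) ⟩
    home (orig (tgt j))          ≡⟨ home-orig (tgt j) ⟩
    homeOrig (tgt j)             ≡⟨ homeOrig-tgt (tgt j) (cong tgt (sym (hasTgt⁻ j h))) ⟩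
    atTgtOf (σ (tgt j))          ≡⟨ cong atTgtOf (hasTgt⁻ j h) ⟩
    atTgtOf j                    ∎
  ... | atMid t = begin
    home (place (homeInner (j , t)))  ≡⟨ cong home (place-homeInner j t) ⟩
    home (inner j t)                  ≡⟨ home-inner j t ⟩
    homeInner (j , t)                 ∎

  upper : ∃[ s ] s ≤ T × HasDomColoring S s
  upper = dropUnusedColours glue
    where
      open Glue S (suc m') Piece (λ j p → place (j , p)) home place∘home home∘place
                (λ j p q a → chainAdj⁺ j _ _ (emb-adj⁺ (shape j) p q a))
                (λ j p q a → emb-adj⁻ (shape j) p q (chainAdj⁻ (loopless simple j) _ _ a))
                pieceColouring pieceColouring-isPartial palettes-disjoint

chiDD-≤ : ∀ {G a t} → IsChiDD G a → ∃[ s ] s ≤ t × HasDomColoring G s → a ≤ t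
chiDD-≤ (_ , minimal) (s , s≤t , colouring) = ≤-trans (minimal s colouring) s≤t

theorem5 : (G : Graph) → Simple G → Connected G → 1 ≤ numEdges G →
    (k : ℕ) → 2 ≤ k →
    (a b c : ℕ) → IsChiDD (pathGraph (k + 1)) a → IsChiDD (subdivision k G) b →
    IsChiDD (pathGraph k) c →
    (a ≤ b) × (b ≤ (numEdges G ∸ 1) * c + a)
theorem5 (mkGraph _ []) _ _ () _ _ _ _ _ _ _ _
theorem5 (mkGraph V₀ (e₀ ∷ es)) simple connected _ (suc (suc r)) (s≤s (s≤s z≤n)) a b c χa χb χc =
  chiDD-≤ χa′ (LowerBound.lower G r simple zero (proj₁ χb)) ,
  chiDD-≤ χb (UpperBound.upper V₀ e₀ es r simple connected (partial χa′) (partial χc))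
  where
    G = mkGraph V₀ (e₀ ∷ es)
    χa′ : IsChiDD (Chain r) a
    χa′ = subst (λ n → IsChiDD (pathGraph n) a) (cong (λ n → suc (suc n)) (+-comm r 1)) χa
    partial : ∀ {H t} (χ : IsChiDD H t) → IsPartialDomColoring H (proj₁ (proj₁ χ)) U
    partial χ = isDomColoring⇒isPartial (proj₂ (proj₁ χ))
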